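{- Let $S$ be a set of $w$-bit integers, viewed as root-to-leaf paths in the binary trie of depth $w$ (the primary trie). Given a query interval $[a,b]$, let $v$ be the lowest common ancestor of $a$ and $b$ in the primary trie, and suppose $v$ lies on a path corresponding to an element of $S$ but is not a branching node (a node where paths to elements of $S$ split; roots are considered branching). Let $w$ be the highest branching node in the subtree of $v$ (the branching descendant of $v$'s lowest branching ancestor that lies under $v$; a leaf corresponding to an element of $S$ counts as a branching node here). Then if $[a,b] \cap S \neq \emptyset$, either the leftmost or the rightmost value of $S$ lying under $w$ belongs to $[a,b]$.
   Context: Reasoning: since $v$ is the lowest common ancestor of $a$ and $b$, the interval $[a,b]$ is contained in the interval spanned by $v$ and straddles its middle point. Since $v$ is not branching, all elements of $S$ under $v$ lie under $w$, on one side of this middle point, so $[a,b]$ meets that side in a prefix or suffix, which, if it contains any element of $S$, contains the rightmost or leftmost element of $S$ under $w$. -}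

module Defs where

open import Data.Nat using (ℕ; zero; suc; _+_; _*_; _∸_; _^_; _≤_; _<_)
open import Data.Product using (Σ; ∃; _×_; _,_)
open import Data.Sum using (_⊎_)
open import Data.List using (List)
open import Data.List.Membership.Propositional using (_∈_)
open import Relation.Binary.PropositionalEquality using (_≡_)

-- Primary trie of depth w over w-bit integers 0 .. 2^w - 1.
-- A node is a pair (d , p): depth d (0 = root, w = leaf) and prefix p,
-- i.e. the number formed by the first d bits.
ValidNode : ℕ → ℕ → ℕ → Set
ValidNode w d p = d ≤ w × p < 2 ^ d

Under : ℕ → ℕ → ℕ → ℕ → Set
Under w d p x = p * 2 ^ (w ∸ d) ≤ x × x < suc p * 2 ^ (w ∸ d)

DescOf : ℕ → ℕ → ℕ → ℕ → Set
DescOf d p d' p' = d ≤ d' × (p * 2 ^ (d' ∸ d) ≤ p' × p' < suc p * 2 ^ (d' ∸ d))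

Occupied : ℕ → List ℕ → ℕ → ℕ → Set
Occupied w S d p = ∃ λ x → x ∈ S × Under w d p x

Branching : ℕ → List ℕ → ℕ → ℕ → Set
Branching w S d p =
  d ≡ 0
  ⊎ (suc d ≤ w × Occupied w S (suc d) (2 * p) × Occupied w S (suc d) (suc (2 * p)))
  ⊎ (d ≡ w × Occupied w S d p)

IsLCA : ℕ → ℕ → ℕ → ℕ → ℕ → Set
IsLCA w a b d p =
  ValidNode w d p × Under w d p a × Under w d p b
  × (∀ d' p' → ValidNode w d' p' → Under w d' p' a → Under w d' p' b → d' ≤ d)

IsHighestBranchingBelow : ℕ → List ℕ → ℕ → ℕ → ℕ → ℕ → Set
IsHighestBranchingBelow w S dv pv d p =
  ValidNode w d p × DescOf dv pv d p × Branching w S d p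
  × (∀ d' p' → ValidNode w d' p' → DescOf dv pv d' p' → Branching w S d' p' → d ≤ d')

IsLeftmostUnder : ℕ → List ℕ → ℕ → ℕ → ℕ → Set
IsLeftmostUnder w S d p x =
  x ∈ S × Under w d p x × (∀ y → y ∈ S → Under w d p y → x ≤ y)

IsRightmostUnder : ℕ → List ℕ → ℕ → ℕ → ℕ → Set
IsRightmostUnder w S d p x =
  x ∈ S × Under w d p x × (∀ y → y ∈ S → Under w d p y → y ≤ x)

-- Let v = (dv , pv) be the lowest common ancestor of a and b.  Then a lies under
-- the left child of v and b under the right one, so a < midpoint ≤ b.  As v is
-- not branching, no node between v and the highest branching node u = (d , p)
-- below it splits S, so every element of S under v lies under u, and u lies
-- under a single child of v.  If x ∈ S ∩ [a,b] lies left of the midpoint, then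
-- so does the rightmost element r of S under u, and a ≤ x ≤ r < midpoint ≤ b;
-- symmetrically on the right with the leftmost element.
module Submission where

open import Defs
open import Data.Nat using (ℕ; zero; suc; _+_; _*_; _∸_; _^_; _≤_; _<_; z≤n; s≤s; _≤?_; _<?_)
open import Data.Nat.Properties
open import Data.Nat.Tactic.RingSolver using (solve-∀)
open import Data.Product using (∃; _×_; _,_; proj₁; proj₂)
open import Data.Sum using (_⊎_; inj₁; inj₂)
open import Data.Empty using (⊥; ⊥-elim)
open import Data.List using (List; filter)
open import Data.List.Relation.Unary.All using (All)
import Data.List.Relation.Unary.All as All
open import Data.List.Membership.Propositional using (_∈_)
open import Data.List.Membership.Propositional.Properties using (∈-filter⁺; ∈-filter⁻)
open import Data.List.Extrema.Nat using (max; min; argmax-all; argmin-all; xs≤max; min≤xs)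
open import Function using (id)
open import Relation.Nullary using (¬_; Dec; yes; no)
open import Relation.Nullary.Decidable using (_×-dec_)
open import Relation.Unary using (Decidable)
open import Relation.Binary.PropositionalEquality
open import Relation.Binary.Definitions using (tri<; tri≈; tri>)

module _ {P : ℕ → Set} (P? : Decidable P) where

  greatest-satisfying : ∀ {S x} → x ∈ S → P x →
    ∃ λ m → m ∈ S × P m × (∀ y → y ∈ S → P y → y ≤ m)
  greatest-satisfying {S} {x} x∈S Px = max x T , proj₁ m∈S×Pm , proj₂ m∈S×Pm , bound
    where
    T = filter P? S
    m∈S×Pm : max x T ∈ S × P (max x T)
    m∈S×Pm = argmax-all id (x∈S , Px) (All.tabulate (∈-filter⁻ P?))
    bound : ∀ y → y ∈ S → P y → y ≤ max x T
    bound y y∈S Py = All.lookup (xs≤max x T) (∈-filter⁺ P? y∈S Py)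

  least-satisfying : ∀ {S x} → x ∈ S → P x →
    ∃ λ m → m ∈ S × P m × (∀ y → y ∈ S → P y → m ≤ y)
  least-satisfying {S} {x} x∈S Px = min x T , proj₁ m∈S×Pm , proj₂ m∈S×Pm , bound
    where
    T = filter P? S
    m∈S×Pm : min x T ∈ S × P (min x T)
    m∈S×Pm = argmin-all id (x∈S , Px) (All.tabulate (∈-filter⁻ P?))
    bound : ∀ y → y ∈ S → P y → min x T ≤ y
    bound y y∈S Py = All.lookup (min≤xs x T) (∈-filter⁺ P? y∈S Py)

under? : ∀ w d p x → Dec (Under w d p x)
under? w d p x = (p * 2 ^ (w ∸ d) ≤? x) ×-dec (x <? suc p * 2 ^ (w ∸ d))

rightmostUnder : ∀ w S d p x → x ∈ S → Under w d p x → ∃ (IsRightmostUnder w S d p)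
rightmostUnder w S d p _ = greatest-satisfying (under? w d p)

leftmostUnder : ∀ w S d p x → x ∈ S → Under w d p x → ∃ (IsLeftmostUnder w S d p)
leftmostUnder w S d p _ = least-satisfying (under? w d p)

private
  w∸d≡1+w∸[1+d] : ∀ {d w} → d < w → w ∸ d ≡ suc (w ∸ suc d)
  w∸d≡1+w∸[1+d] = +-∸-assoc 1

  [n∸m]+[o∸n]≡o∸m : ∀ {m n o} → m ≤ n → n ≤ o → (n ∸ m) + (o ∸ n) ≡ o ∸ m
  [n∸m]+[o∸n]≡o∸m z≤n       n≤o       = m+[n∸m]≡n n≤o
  [n∸m]+[o∸n]≡o∸m (s≤s m≤n) (s≤s n≤o) = [n∸m]+[o∸n]≡o∸m m≤n n≤o

  2^[w∸m]≡2^[n∸m]*2^[w∸n] : ∀ {m n w} → m ≤ n → n ≤ w → 2 ^ (w ∸ m) ≡ 2 ^ (n ∸ m) * 2 ^ (w ∸ n)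
  2^[w∸m]≡2^[n∸m]*2^[w∸n] {m} {n} {w} m≤n n≤w = begin
    2 ^ (w ∸ m)                 ≡⟨ cong (2 ^_) ([n∸m]+[o∸n]≡o∸m m≤n n≤w) ⟨
    2 ^ ((n ∸ m) + (w ∸ n))     ≡⟨ ^-distribˡ-+-* 2 (n ∸ m) (w ∸ n) ⟩
    2 ^ (n ∸ m) * 2 ^ (w ∸ n)   ∎
    where open ≡-Reasoning

  r*2^[w∸m]≡r*2^[n∸m]*2^[w∸n] : ∀ r {m n w} → m ≤ n → n ≤ w →
    r * 2 ^ (w ∸ m) ≡ r * 2 ^ (n ∸ m) * 2 ^ (w ∸ n)
  r*2^[w∸m]≡r*2^[n∸m]*2^[w∸n] r {m} {n} {w} m≤n n≤w =
    trans (cong (r *_) (2^[w∸m]≡2^[n∸m]*2^[w∸n] m≤n n≤w)) (sym (*-assoc r (2 ^ (n ∸ m)) (2 ^ (w ∸ n))))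

  p*[2*k]≡[2*p]*k : ∀ p k → p * (2 * k) ≡ (2 * p) * k
  p*[2*k]≡[2*p]*k = solve-∀

  [1+p]*[2*k]≡[2+2*p]*k : ∀ p k → suc p * (2 * k) ≡ suc (suc (2 * p)) * k
  [1+p]*[2*k]≡[2+2*p]*k = solve-∀

-- The children of (d , p) cover [p·2^(w∸d), midpoint) and [midpoint, (p+1)·2^(w∸d)).
midpoint : ℕ → ℕ → ℕ → ℕ
midpoint w d p = suc (2 * p) * 2 ^ (w ∸ suc d)

under-child : ∀ w d p y → d < w → Under w d p y →
  Under w (suc d) (2 * p) y ⊎ Under w (suc d) (suc (2 * p)) y
under-child w d p y d<w (lo , hi) rewrite w∸d≡1+w∸[1+d] d<w with y <? midpoint w d p
... | yes y<mid = inj₁ (subst (_≤ y) (p*[2*k]≡[2*p]*k p (2 ^ (w ∸ suc d))) lo , y<mid)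
... | no  y≮mid = inj₂ (≮⇒≥ y≮mid , subst (y <_) ([1+p]*[2*k]≡[2+2*p]*k p (2 ^ (w ∸ suc d))) hi)

under-left⇒under : ∀ w d p y → d < w → Under w (suc d) (2 * p) y → Under w d p y
under-left⇒under w d p y d<w (lo , y<mid) rewrite w∸d≡1+w∸[1+d] d<w =
  subst (_≤ y) (sym (p*[2*k]≡[2*p]*k p k)) lo ,
  <-≤-trans y<mid (subst (suc (2 * p) * k ≤_) (sym ([1+p]*[2*k]≡[2+2*p]*k p k)) (*-monoˡ-≤ k (n≤1+n (suc (2 * p)))))
  where k = 2 ^ (w ∸ suc d)

under-unique : ∀ w d p q x → Under w d p x → Under w d q x → p ≡ q
under-unique w d p q x (lo , hi) (lo′ , hi′) with <-cmp p q
... | tri≈ _ p≡q _ = p≡q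
... | tri< p<q _ _ = ⊥-elim (<-irrefl refl (<-≤-trans hi (≤-trans (*-monoˡ-≤ (2 ^ (w ∸ d)) p<q) lo′)))
... | tri> _ _ q<p = ⊥-elim (<-irrefl refl (<-≤-trans hi′ (≤-trans (*-monoˡ-≤ (2 ^ (w ∸ d)) q<p) lo)))

under⇒ValidNode : ∀ w d p x → d ≤ w → x < 2 ^ w → Under w d p x → ValidNode w d p
under⇒ValidNode w d p x d≤w x<2^w (lo , _) = d≤w ,
  *-cancelʳ-< (2 ^ (w ∸ d)) p (2 ^ d)
    (≤-<-trans lo (<-≤-trans x<2^w (≤-reflexive (2^[w∸m]≡2^[n∸m]*2^[w∸n] z≤n d≤w))))

under⇒DescOf : ∀ w e q d p y → e ≤ d → d ≤ w → Under w e q y → Under w d p y → DescOf e q d p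
under⇒DescOf w e q d p y e≤d d≤w (lo , hi) (lo′ , hi′) = e≤d ,
  ≤-pred (*-cancelʳ-< B (q * 2 ^ (d ∸ e)) (suc p) (≤-<-trans lo″ hi′)) ,
  *-cancelʳ-< B p (suc q * 2 ^ (d ∸ e)) (≤-<-trans lo′ (<-≤-trans hi (≤-reflexive (split (suc q)))))
  where
  B = 2 ^ (w ∸ d)
  split : ∀ r → r * 2 ^ (w ∸ e) ≡ r * 2 ^ (d ∸ e) * B
  split r = r*2^[w∸m]≡r*2^[n∸m]*2^[w∸n] r e≤d d≤w
  lo″ : q * 2 ^ (d ∸ e) * B ≤ y
  lo″ = subst (_≤ y) (split q) lo

DescOf⇒under : ∀ w e q d p y → DescOf e q d p → d ≤ w → Under w d p y → Under w e q y
DescOf⇒under w e q d p y (e≤d , lo , hi) d≤w (lo′ , hi′) =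
  ≤-trans (≤-reflexive (split q)) (≤-trans (*-monoˡ-≤ B lo) lo′) ,
  <-≤-trans hi′ (≤-trans (*-monoˡ-≤ B hi) (≤-reflexive (sym (split (suc q)))))
  where
  B = 2 ^ (w ∸ d)
  split : ∀ r → r * 2 ^ (w ∸ e) ≡ r * 2 ^ (d ∸ e) * B
  split r = r*2^[w∸m]≡r*2^[n∸m]*2^[w∸n] r e≤d d≤w

under-commonAncestor : ∀ w e q d p x y → e ≤ d → d ≤ w →
  Under w e q x → Under w d p x → Under w d p y → Under w e q y
under-commonAncestor w e q d p x y e≤d d≤w x∈eq x∈dp =
  DescOf⇒under w e q d p y (under⇒DescOf w e q d p x e≤d d≤w x∈eq x∈dp) d≤w

DescOf-refl⇒≡ : ∀ d p q → DescOf d p d q → q ≡ p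
DescOf-refl⇒≡ d p q (_ , lo , hi) rewrite n∸n≡0 d | *-identityʳ p =
  sym (≤-antisym lo (≤-pred hi))

occupied-¬branching⇒<w : ∀ w S d p → d ≤ w → Occupied w S d p → ¬ Branching w S d p → d < w
occupied-¬branching⇒<w w S d p d≤w occ ¬br with m≤n⇒m<n∨m≡n d≤w
... | inj₁ d<w = d<w
... | inj₂ d≡w = ⊥-elim (¬br (inj₂ (inj₂ (d≡w , occ))))

nonRoot-branching⇒occupied : ∀ w S d p → 0 < d → Branching w S d p → Occupied w S d p
nonRoot-branching⇒occupied w S d p 0<d (inj₁ refl) = ⊥-elim (<-irrefl refl 0<d)
nonRoot-branching⇒occupied w S d p 0<d (inj₂ (inj₁ (d<w , (z , z∈S , z∈left) , _))) =
  z , z∈S , under-left⇒under w d p z d<w z∈left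
nonRoot-branching⇒occupied w S d p 0<d (inj₂ (inj₂ (_ , occ))) = occ

lca-straddles-midpoint : ∀ w a b dv pv → a ≤ b → b < 2 ^ w → dv < w → IsLCA w a b dv pv →
  a < midpoint w dv pv × midpoint w dv pv ≤ b
lca-straddles-midpoint w a b dv pv a≤b b<2^w dv<w (_ , a∈v , b∈v , lowest)
  with under-child w dv pv a dv<w a∈v | under-child w dv pv b dv<w b∈v
... | inj₁ a∈left  | inj₂ b∈right = proj₂ a∈left , proj₁ b∈right
... | inj₂ a∈right | inj₁ b∈left  = ⊥-elim (<-irrefl refl (≤-<-trans (≤-trans (proj₁ a∈right) a≤b) (proj₂ b∈left)))
... | inj₁ a∈left  | inj₁ b∈left  = ⊥-elim (<-irrefl refl (lowest _ _ (valid a∈left) a∈left b∈left))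
  where valid = under⇒ValidNode w (suc dv) (2 * pv) a dv<w (≤-<-trans a≤b b<2^w)
... | inj₂ a∈right | inj₂ b∈right = ⊥-elim (<-irrefl refl (lowest _ _ (valid a∈right) a∈right b∈right))
  where valid = under⇒ValidNode w (suc dv) (suc (2 * pv)) a dv<w (≤-<-trans a≤b b<2^w)

module NoBranchingAbove (w : ℕ) (S : List ℕ) (S<2^w : All (_< 2 ^ w) S) (dv pv d : ℕ) (d≤w : d ≤ w)
  (highest : ∀ d′ p′ → ValidNode w d′ p′ → DescOf dv pv d′ p′ → Branching w S d′ p′ → d ≤ d′) where

  no-split : ∀ e q y z → dv ≤ e → e < d → y ∈ S → z ∈ S → Under w dv pv y →
    Under w (suc e) (2 * q) y → Under w (suc e) (suc (2 * q)) z → ⊥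
  no-split e q y z dv≤e e<d y∈S z∈S y∈v y∈left z∈right =
    <⇒≱ e<d (highest e q (under⇒ValidNode w e q y e≤w (All.lookup S<2^w y∈S) y∈eq)
                         (under⇒DescOf w dv pv e q y dv≤e e≤w y∈v y∈eq)
                         (inj₂ (inj₁ (e<w , (y , y∈S , y∈left) , (z , z∈S , z∈right)))))
    where
    e<w = <-≤-trans e<d d≤w
    e≤w = <⇒≤ e<w
    y∈eq = under-left⇒under w e q y e<w y∈left

  shared-ancestor : ∀ n → dv + n ≤ d → ∀ y z → y ∈ S → z ∈ S → Under w dv pv y → Under w dv pv z →
    ∃ λ q → Under w (dv + n) q y × Under w (dv + n) q z
  shared-ancestor zero _ y z _ _ y∈v z∈v rewrite +-identityʳ dv = pv , y∈v , z∈v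
  shared-ancestor (suc n) dv+n<d y z y∈S z∈S y∈v z∈v rewrite +-suc dv n
    with shared-ancestor n (<⇒≤ dv+n<d) y z y∈S z∈S y∈v z∈v
  ... | q , y∈q , z∈q with under-child w (dv + n) q y e<w y∈q | under-child w (dv + n) q z e<w z∈q
    where e<w = <-≤-trans dv+n<d d≤w
  ... | inj₁ y∈left  | inj₁ z∈left  = 2 * q , y∈left , z∈left
  ... | inj₂ y∈right | inj₂ z∈right = suc (2 * q) , y∈right , z∈right
  ... | inj₁ y∈left  | inj₂ z∈right = ⊥-elim (no-split (dv + n) q y z (m≤m+n dv n) dv+n<d y∈S z∈S y∈v y∈left z∈right)
  ... | inj₂ y∈right | inj₁ z∈left  = ⊥-elim (no-split (dv + n) q z y (m≤m+n dv n) dv+n<d z∈S y∈S z∈v z∈left y∈right)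

  under-highestBranching : ∀ p → DescOf dv pv d p → Occupied w S d p →
    ∀ y → y ∈ S → Under w dv pv y → Under w d p y
  under-highestBranching p desc (z , z∈S , z∈w) y y∈S y∈v
    with shared-ancestor (d ∸ dv) (≤-reflexive (m+[n∸m]≡n (proj₁ desc))) y z y∈S z∈S y∈v
                         (DescOf⇒under w dv pv d p z desc d≤w z∈w)
  ... | q , y∈q , z∈q rewrite m+[n∸m]≡n (proj₁ desc) =
    subst (λ r → Under w d r y) (under-unique w d q p z z∈q z∈w) y∈q

mainTheorem6 : (w : ℕ) (S : List ℕ) → All (λ x → x < 2 ^ w) S
    → (a b : ℕ) → a ≤ b → b < 2 ^ w
    → (dv pv : ℕ) → IsLCA w a b dv pv
    → Occupied w S dv pv → ¬ Branching w S dv pv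
    → (d p : ℕ) → IsHighestBranchingBelow w S dv pv d p
    → (∃ λ x → x ∈ S × a ≤ x × x ≤ b)
    → (∃ λ x → IsLeftmostUnder w S d p x × a ≤ x × x ≤ b)
      ⊎ (∃ λ x → IsRightmostUnder w S d p x × a ≤ x × x ≤ b)
mainTheorem6 w S S<2^w a b a≤b b<2^w dv pv lca@((dv≤w , _) , a∈v , b∈v , _) occ ¬br
             d p ((d≤w , _) , desc@(dv≤d , _) , br , highest) (x , x∈S , a≤x , x≤b)
  = extremum (under-child w dv pv x dv<w x∈v)
  where
  open NoBranchingAbove w S S<2^w dv pv d d≤w highest
  dv<w = occupied-¬branching⇒<w w S dv pv dv≤w occ ¬br
  straddle = lca-straddles-midpoint w a b dv pv a≤b b<2^w dv<w lca
  dv<d : dv < d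
  dv<d with m≤n⇒m<n∨m≡n dv≤d
  ... | inj₁ dv<d = dv<d
  ... | inj₂ refl = ⊥-elim (¬br (subst (Branching w S dv) (DescOf-refl⇒≡ dv pv p desc) br))
  occupied = nonRoot-branching⇒occupied w S d p (≤-<-trans z≤n dv<d) br
  x∈v = ≤-trans (proj₁ a∈v) a≤x , ≤-<-trans x≤b (proj₂ b∈v)
  x∈w = under-highestBranching p desc occupied x x∈S x∈v
  same-child : ∀ c y → Under w (suc dv) c x → Under w d p y → Under w (suc dv) c y
  same-child c y x∈c = under-commonAncestor w (suc dv) c d p x y dv<d d≤w x∈c x∈w
  extremum : Under w (suc dv) (2 * pv) x ⊎ Under w (suc dv) (suc (2 * pv)) x
    → (∃ λ x → IsLeftmostUnder w S d p x × a ≤ x × x ≤ b)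
      ⊎ (∃ λ x → IsRightmostUnder w S d p x × a ≤ x × x ≤ b)
  extremum (inj₁ x∈left) with rightmostUnder w S d p x x∈S x∈w
  ... | r , rightmost@(_ , r∈w , r-max) =
    inj₂ (r , rightmost , ≤-trans a≤x (r-max x x∈S x∈w) ,
          <⇒≤ (<-≤-trans (proj₂ (same-child (2 * pv) r x∈left r∈w)) (proj₂ straddle)))
  extremum (inj₂ x∈right) with leftmostUnder w S d p x x∈S x∈w
  ... | l , leftmost@(_ , l∈w , l-min) =
    inj₁ (l , leftmost , <⇒≤ (<-≤-trans (proj₁ straddle) (proj₁ (same-child (suc (2 * pv)) l x∈right l∈w))) ,
          ≤-trans (l-min x x∈S x∈w) x≤b)
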